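{- Let $n, r$ be two positive integers and let $G$ be a graph all of whose vertices have degree at least $r$. Then $$m_e(G\square K_n, r)\leqslant\sum_{t=0}^{n-1} m_e(G, r-t),$$ where $m_e(G,i)$ is defined to be $0$ if $i\leqslant 0$.
   Context: All graphs are finite, simple and undirected. $K_n$ is the complete graph on $n$ vertices; $G\square H$ denotes the Cartesian product: vertex set $V(G)\times V(H)$, with $(g_1,h_1)$ adjacent to $(g_2,h_2)$ iff either $g_1=g_2$ and $h_1h_2\in E(H)$, or $h_1=h_2$ and $g_1g_2\in E(G)$. Given graphs $G$ and $H$, the $H$-bootstrap percolation process on $G$ starts with a set $E_0\subseteq E(G)$ of initially activated edges, and for $i\geqslant 1$, $E_i$ is $E_{i-1}$ together with every edge $e\in E(G)$ for which there is a subgraph $H_e$ of $G$ isomorphic to $H$ with $e\in E(H_e)$ and $E(H_e)\setminus\{e\}\subseteq E_{i-1}$. $E_0$ is a percolating set if $\bigcup_{i\geqslant0}E_i=E(G)$. $\mathrm{wsat}(G,H)$ is the minimum size of a percolating set. For an integer $r\geqslant 0$, $m_e(G,r)=\mathrm{wsat}(G,S_{r+1})$, where $S_{r+1}$ is the star graph on $r+2$ vertices. -}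

module Defs where

open import Data.Nat using (ℕ; zero; suc; _+_; _*_; _≤_; _<_; _<ᵇ_)
open import Data.Nat.Properties using (_<?_)
open import Data.Bool using (Bool; true; false; if_then_else_)
open import Data.Fin using (Fin; zero; suc; toℕ; remQuot)
open import Data.Fin.Properties using (_≟_)
open import Data.Product using (_×_; _,_; proj₁; proj₂; Σ; ∃)
open import Data.Sum using (_⊎_; inj₁; inj₂)
open import Data.Empty using (⊥)
open import Data.Unit using (⊤)
open import Relation.Nullary using (¬_; Dec; yes; no)
open import Relation.Nullary.Decidable using (⌊_⌋; _×-dec_; _⊎-dec_; ¬?)
open import Relation.Binary.PropositionalEquality using (_≡_; refl; sym)
open import Function.Definitions using (Injective)

record Graph : Set₁ where
  field
    n      : ℕ
    Adj    : Fin n → Fin n → Set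
    adj?   : ∀ i j → Dec (Adj i j)
    adjSym : ∀ {i j} → Adj i j → Adj j i
    adjIrrefl : ∀ {i} → ¬ Adj i i
open Graph public

sumFin : ∀ k → (Fin k → ℕ) → ℕ
sumFin zero    f = 0
sumFin (suc k) f = f zero + sumFin k (λ i → f (suc i))

sumTo : ℕ → (ℕ → ℕ) → ℕ
sumTo zero    f = 0
sumTo (suc k) f = sumTo k f + f k

b2n : Bool → ℕ
b2n true  = 1
b2n false = 0

degree : (G : Graph) → Fin (n G) → ℕ
degree G v = sumFin (n G) (λ w → b2n ⌊ adj? G v w ⌋)

MinDegreeAtLeast : Graph → ℕ → Set
MinDegreeAtLeast G r = ∀ v → r ≤ degree G v

K : ℕ → Graph
K m = record
  { n = m
  ; Adj = λ i j → ¬ (i ≡ j)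
  ; adj? = λ i j → ¬? (i ≟ j)
  ; adjSym = λ ne eq → ne (sym eq)
  ; adjIrrefl = λ ne → ne refl }

-- star S_k : centre zero joined to k leaves (k+1 vertices)
StarAdj : ∀ {k} → Fin (suc k) → Fin (suc k) → Set
StarAdj zero    zero    = ⊥
StarAdj zero    (suc _) = ⊤
StarAdj (suc _) zero    = ⊤
StarAdj (suc _) (suc _) = ⊥

starAdj? : ∀ {k} (i j : Fin (suc k)) → Dec (StarAdj i j)
starAdj? zero    zero    = no (λ ())
starAdj? zero    (suc _) = yes _
starAdj? (suc _) zero    = yes _
starAdj? (suc _) (suc _) = no (λ ())

starSym : ∀ {k} {i j : Fin (suc k)} → StarAdj i j → StarAdj j i
starSym {i = zero}  {suc _} p = _
starSym {i = suc _} {zero}  p = _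

starIrrefl : ∀ {k} {i : Fin (suc k)} → ¬ StarAdj i i
starIrrefl {i = zero}  ()
starIrrefl {i = suc _} ()

Star : ℕ → Graph
Star k = record
  { n = suc k ; Adj = StarAdj ; adj? = starAdj? ; adjSym = starSym ; adjIrrefl = starIrrefl }

-- Cartesian product G □ H, vertex x ↔ remQuot x = (g , h)
module _ (G H : Graph) where
  private
    π : Fin (n G * n H) → Fin (n G) × Fin (n H)
    π = remQuot (n H)

  □Adj : Fin (n G * n H) → Fin (n G * n H) → Set
  □Adj x y = (proj₁ (π x) ≡ proj₁ (π y) × Adj H (proj₂ (π x)) (proj₂ (π y)))
           ⊎ (proj₂ (π x) ≡ proj₂ (π y) × Adj G (proj₁ (π x)) (proj₁ (π y)))

  □adj? : ∀ x y → Dec (□Adj x y)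
  □adj? x y = ((proj₁ (π x) ≟ proj₁ (π y)) ×-dec adj? H _ _)
        ⊎-dec ((proj₂ (π x) ≟ proj₂ (π y)) ×-dec adj? G _ _)

  □sym : ∀ {x y} → □Adj x y → □Adj y x
  □sym (inj₁ (e , a)) = inj₁ (sym e , adjSym H a)
  □sym (inj₂ (e , a)) = inj₂ (sym e , adjSym G a)

  □irrefl : ∀ {x} → ¬ □Adj x x
  □irrefl (inj₁ (_ , a)) = adjIrrefl H a
  □irrefl (inj₂ (_ , a)) = adjIrrefl G a

_□_ : Graph → Graph → Graph
G □ H = record
  { n = n G * n H ; Adj = □Adj G H ; adj? = □adj? G H ; adjSym = □sym G H ; adjIrrefl = □irrefl G H }

record EdgeSet (G : Graph) : Set where
  field
    mem    : Fin (n G) → Fin (n G) → Bool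
    memSym : ∀ i j → mem i j ≡ mem j i
    sub    : ∀ i j → mem i j ≡ true → Adj G i j
open EdgeSet public

size : {G : Graph} → EdgeSet G → ℕ
size {G} E = sumFin (n G) (λ i → sumFin (n G) (λ j →
  if toℕ i <ᵇ toℕ j then b2n (mem E i j) else 0))

SameEdge : ∀ {k} → Fin k → Fin k → Fin k → Fin k → Set
SameEdge c d a b = (c ≡ a × d ≡ b) ⊎ (c ≡ b × d ≡ a)

-- Active H G E0 u v : the edge uv lies in ⋃ᵢ Eᵢ.
data Active (H G : Graph) (E0 : EdgeSet G) : Fin (n G) → Fin (n G) → Set where
  init : ∀ {u v} → mem E0 u v ≡ true → Active H G E0 u v
  step : ∀ {u v}
         (f : Fin (n H) → Fin (n G)) → Injective _≡_ _≡_ f →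
         (∀ c d → Adj H c d → Adj G (f c) (f d)) →
         (a b : Fin (n H)) → Adj H a b → f a ≡ u → f b ≡ v →
         (∀ c d → Adj H c d → ¬ SameEdge c d a b → Active H G E0 (f c) (f d)) →
         Active H G E0 u v

Percolates : (G H : Graph) → EdgeSet G → Set
Percolates G H E0 = ∀ u v → Adj G u v → Active H G E0 u v

IsWsat : Graph → Graph → ℕ → Set
IsWsat G H k =
  (Σ (EdgeSet G) λ E → Percolates G H E × size E ≡ k) ×
  (∀ (E : EdgeSet G) → Percolates G H E → k ≤ size E)

-- IsMe G r k : k = m_e(G, r) = wsat(G, S_{r+1})
IsMe : Graph → ℕ → ℕ → Set
IsMe G r k = IsWsat G (Star (suc r)) k

module Submission where

-- Think of G □ K_n as n stacked copies ("layers") G × {t} of G, any two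
-- copies of a vertex g being joined by a "vertical" edge.  For each layer t < r
-- put a minimum S_{r-t+1}-percolating set of G into that layer; layers t ≥ r get
-- nothing.  This edge set has size Σ_{t<n, t<r} m_e(G, r - t), and it
-- S_{r+1}-percolates by induction on t:
--   * once layers s < t are fully active, every vertical edge (g,s)(g,t) is the
--     last edge of a star centred at (g,s) whose other leaves are r neighbours of
--     g inside layer s (min degree r);
--   * once all vertical edges into layer t are active, each vertex of layer t has
--     t extra active edges, so S_{r-t+1}-percolation of the set in layer t lifts
--     to S_{r+1}-percolation (t < r), or every edge of layer t is closed directly
--     by a star using r vertical edges (t ≥ r).

open import Defs
open import Data.Nat using (ℕ; zero; suc; _+_; _*_; _∸_; _≤_; _<_; _<ᵇ_; z≤n; s≤s⁻¹)
open import Data.Nat.Properties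
  using (+-assoc; +-identityʳ; +-mono-≤; +-commutativeSemigroup; ≤-refl; <⇒≤; ≮⇒≥; _<?_;
         m∸n+n≡m; <ᵇ-reflects-<; *-cancelˡ-<; +-cancelʳ-<; module ≤-Reasoning)
open import Algebra.Properties.CommutativeSemigroup +-commutativeSemigroup using (interchange)
open import Data.Fin using (Fin; zero; suc; toℕ; _↑ˡ_; _↑ʳ_; splitAt; combine; remQuot; inject; inject≤)
open import Data.Fin.Properties
  using (_≟_; <-cmp; <⇒≢; suc-injective; toℕ<n; toℕ-injective; toℕ-inject; inject≤-injective;
         splitAt-↑ˡ; splitAt-↑ʳ; splitAt⁻¹-↑ˡ; splitAt⁻¹-↑ʳ; combine-injective;
         remQuot-combine; combine-remQuot; toℕ-combine)
open import Data.Fin.Induction using (<-wellFounded)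
open import Induction.WellFounded using (module All)
open import Data.Product using (_×_; _,_; proj₁; proj₂; Σ)
open import Data.Sum using (_⊎_; inj₁; inj₂; [_,_]′)
open import Data.Bool using (Bool; true; false; if_then_else_)
open import Data.Bool.Properties using (if-eta)
open import Data.Unit using (tt)
open import Data.Empty using (⊥-elim)
open import Relation.Binary using (tri<; tri≈; tri>)
open import Relation.Nullary using (¬_; Dec; yes; no)
open import Relation.Nullary.Reflects using (ofʸ; ofⁿ)
open import Relation.Nullary.Decidable using (⌊_⌋)
open import Relation.Binary.PropositionalEquality
  using (_≡_; _≢_; refl; sym; trans; cong; cong₂; subst; subst₂)
open import Function.Definitions using (Injective)

sumFin-cong : ∀ k {f g : Fin k → ℕ} → (∀ i → f i ≡ g i) → sumFin k f ≡ sumFin k g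
sumFin-cong zero    f≗g = refl
sumFin-cong (suc k) f≗g = cong₂ _+_ (f≗g zero) (sumFin-cong k (λ i → f≗g (suc i)))

sumFin-mono : ∀ k {f g : Fin k → ℕ} → (∀ i → f i ≤ g i) → sumFin k f ≤ sumFin k g
sumFin-mono zero    f≤g = z≤n
sumFin-mono (suc k) f≤g = +-mono-≤ (f≤g zero) (sumFin-mono k (λ i → f≤g (suc i)))

sumFin-zero : ∀ k → sumFin k (λ _ → 0) ≡ 0
sumFin-zero zero    = refl
sumFin-zero (suc k) = sumFin-zero k

sumFin-+ : ∀ k (f g : Fin k → ℕ) → sumFin k (λ i → f i + g i) ≡ sumFin k f + sumFin k g
sumFin-+ zero    f g = refl
sumFin-+ (suc k) f g = trans (cong (f zero + g zero +_) (sumFin-+ k (λ i → f (suc i)) (λ i → g (suc i))))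
                             (interchange (f zero) (g zero) _ _)

sumFin-swap : ∀ a b (F : Fin a → Fin b → ℕ) →
  sumFin a (λ i → sumFin b (F i)) ≡ sumFin b (λ j → sumFin a (λ i → F i j))
sumFin-swap zero    b F = sym (sumFin-zero b)
sumFin-swap (suc a) b F =
  trans (cong (sumFin b (F zero) +_) (sumFin-swap a b (λ i → F (suc i))))
        (sym (sumFin-+ b (F zero) (λ j → sumFin a (λ i → F (suc i) j))))

sumFin-++ : ∀ a b (F : Fin (a + b) → ℕ) →
  sumFin (a + b) F ≡ sumFin a (λ i → F (i ↑ˡ b)) + sumFin b (λ j → F (a ↑ʳ j))
sumFin-++ zero    b F = refl
sumFin-++ (suc a) b F = trans (cong (F zero +_) (sumFin-++ a b (λ i → F (suc i)))) (sym (+-assoc (F zero) _ _))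

sumFin-combine : ∀ a b (F : Fin (a * b) → ℕ) →
  sumFin (a * b) F ≡ sumFin a (λ i → sumFin b (λ j → F (combine i j)))
sumFin-combine zero    b F = refl
sumFin-combine (suc a) b F = trans (sumFin-++ b (a * b) F)
  (cong (sumFin b (λ j → F (j ↑ˡ (a * b))) +_) (sumFin-combine a b (λ x → F (b ↑ʳ x))))

sumFin-delta : ∀ k (h : Fin k) (x : ℕ) → sumFin k (λ h′ → if ⌊ h ≟ h′ ⌋ then x else 0) ≡ x
sumFin-delta (suc k) zero    x = trans (cong (x +_) (sumFin-zero k)) (+-identityʳ x)
sumFin-delta (suc k) (suc h) x = trans (sumFin-cong k shift) (sumFin-delta k h x)
  where
  shift : ∀ i → (if ⌊ suc h ≟ suc i ⌋ then x else 0) ≡ (if ⌊ h ≟ i ⌋ then x else 0)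
  shift i with h ≟ i
  ... | yes _ = refl
  ... | no  _ = refl

sumTo-unshift : ∀ k (W : ℕ → ℕ) → sumTo (suc k) W ≡ W 0 + sumTo k (λ t → W (suc t))
sumTo-unshift zero    W = sym (+-identityʳ (W 0))
sumTo-unshift (suc k) W = trans (cong (_+ W (suc k)) (sumTo-unshift k W)) (+-assoc (W 0) _ _)

sumFin-sumTo : ∀ k (W : ℕ → ℕ) → sumFin k (λ h → W (toℕ h)) ≡ sumTo k W
sumFin-sumTo zero    W = refl
sumFin-sumTo (suc k) W = trans (cong (W 0 +_) (sumFin-sumTo k (λ t → W (suc t)))) (sym (sumTo-unshift k W))

count : ∀ {N} {P : Fin N → Set} → (∀ i → Dec (P i)) → ℕ
count {N} P? = sumFin N (λ i → b2n ⌊ P? i ⌋)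

choose : ∀ {N} (P : Fin N → Set) (P? : ∀ i → Dec (P i)) r → r ≤ count P? →
  Σ (Fin r → Fin N) λ w → Injective _≡_ _≡_ w × (∀ i → P (w i))
choose P P? zero _ = (λ ()) , (λ { {()} }) , (λ ())
choose {suc N} P P? (suc r) r+1≤count with P? zero
... | yes p =
  let (w , w-inj , w-P) = choose (λ i → P (suc i)) (λ i → P? (suc i)) r (s≤s⁻¹ r+1≤count)
  in w′ w , w′-inj w-inj , w′-P w-P
  where
  w′ : (Fin r → Fin N) → Fin (suc r) → Fin (suc N)
  w′ w zero    = zero
  w′ w (suc i) = suc (w i)
  w′-inj : ∀ {w} → Injective _≡_ _≡_ w → Injective _≡_ _≡_ (w′ w)
  w′-inj w-inj {zero}  {zero}  _  = refl
  w′-inj w-inj {suc i} {suc j} eq = cong suc (w-inj (suc-injective eq))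
  w′-P : ∀ {w} → (∀ i → P (suc (w i))) → ∀ i → P (w′ w i)
  w′-P w-P zero    = p
  w′-P w-P (suc i) = w-P i
... | no _ =
  let (w , w-inj , w-P) = choose (λ i → P (suc i)) (λ i → P? (suc i)) (suc r) r+1≤count
  in (λ i → suc (w i)) , (λ eq → w-inj (suc-injective eq)) , w-P

SameEdge-flip : ∀ {k} {c d a b : Fin k} → SameEdge c d b a → SameEdge c d a b
SameEdge-flip (inj₁ (c≡b , d≡a)) = inj₂ (c≡b , d≡a)
SameEdge-flip (inj₂ (c≡a , d≡b)) = inj₁ (c≡a , d≡b)

active-sym : ∀ {H G E u v} → Active H G E u v → Active H G E v u
active-sym {E = E} {u} {v} (init uv∈E) = init (trans (memSym E v u) uv∈E)
active-sym {H = H} (step f f-inj f-hom a b ab fa≡u fb≡v rest) =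
  step f f-inj f-hom b a (adjSym H ab) fb≡v fa≡u (λ c d cd ne → rest c d cd (λ same → ne (SameEdge-flip same)))

star-rule : ∀ {G E k u v} → Adj G u v →
  (w : Fin k → Fin (n G)) → Injective _≡_ _≡_ w → (∀ i → Adj G u (w i)) → (∀ i → w i ≢ v) →
  (∀ i → Active (Star (suc k)) G E u (w i)) → Active (Star (suc k)) G E u v
star-rule {G} {E} {k} {u} {v} uv w w-inj uw w≢v uw-active =
  step f f-inj f-hom zero (suc zero) tt refl refl rest
  where
  f : Fin (suc (suc k)) → Fin (n G)
  f zero          = u
  f (suc zero)    = v
  f (suc (suc i)) = w i

  u≢ : ∀ {x} → Adj G u x → u ≢ x
  u≢ ux refl = adjIrrefl G ux

  f-inj : Injective _≡_ _≡_ f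
  f-inj {zero}          {zero}          _  = refl
  f-inj {zero}          {suc zero}      eq = ⊥-elim (u≢ uv eq)
  f-inj {zero}          {suc (suc j)}   eq = ⊥-elim (u≢ (uw j) eq)
  f-inj {suc zero}      {zero}          eq = ⊥-elim (u≢ uv (sym eq))
  f-inj {suc zero}      {suc zero}      _  = refl
  f-inj {suc zero}      {suc (suc j)}   eq = ⊥-elim (w≢v j (sym eq))
  f-inj {suc (suc i)}   {zero}          eq = ⊥-elim (u≢ (uw i) (sym eq))
  f-inj {suc (suc i)}   {suc zero}      eq = ⊥-elim (w≢v i eq)
  f-inj {suc (suc i)}   {suc (suc j)}   eq = cong (λ x → suc (suc x)) (w-inj eq)

  f-hom : ∀ c d → StarAdj c d → Adj G (f c) (f d)
  f-hom zero          (suc zero)    _ = uv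
  f-hom zero          (suc (suc i)) _ = uw i
  f-hom (suc zero)    zero          _ = adjSym G uv
  f-hom (suc (suc i)) zero          _ = adjSym G (uw i)

  rest : ∀ c d → StarAdj c d → ¬ SameEdge c d zero (suc zero) → Active (Star (suc k)) G E (f c) (f d)
  rest zero          (suc zero)    _ ne = ⊥-elim (ne (inj₁ (refl , refl)))
  rest zero          (suc (suc i)) _ _  = uw-active i
  rest (suc zero)    zero          _ ne = ⊥-elim (ne (inj₂ (refl , refl)))
  rest (suc (suc i)) zero          _ _  = active-sym (uw-active i)

data Split (m n : ℕ) : Fin (m + n) → Set where
  left  : (i : Fin m) → Split m n (i ↑ˡ n)
  right : (j : Fin n) → Split m n (m ↑ʳ j)

split : ∀ m {n} (x : Fin (m + n)) → Split m n x
split m {n} x with splitAt m x in eq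
... | inj₁ i = subst (Split m n) (splitAt⁻¹-↑ˡ eq) (left i)
... | inj₂ j = subst (Split m n) (splitAt⁻¹-↑ʳ eq) (right j)

↑ˡ-starAdj : ∀ {k} t (c d : Fin (suc (suc k))) → StarAdj c d → StarAdj (c ↑ˡ t) (d ↑ˡ t)
↑ˡ-starAdj t zero    (suc d) _ = tt
↑ˡ-starAdj t (suc c) zero    _ = tt

↑ˡ-starAdj⁻ : ∀ {k} t (c d : Fin (suc (suc k))) → StarAdj (c ↑ˡ t) (d ↑ˡ t) → StarAdj c d
↑ˡ-starAdj⁻ t zero    (suc d) _ = tt
↑ˡ-starAdj⁻ t (suc c) zero    _ = tt

SameEdge-map : ∀ {k l} (g : Fin k → Fin l) {c d a b} → SameEdge c d a b → SameEdge (g c) (g d) (g a) (g b)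
SameEdge-map g (inj₁ (c≡a , d≡b)) = inj₁ (cong g c≡a , cong g d≡b)
SameEdge-map g (inj₂ (c≡b , d≡a)) = inj₂ (cong g c≡b , cong g d≡a)

-- Then S_{k+1}-activity in G implies S_{k+t+1}-activity in G′: every star used in
-- G is enlarged by the t extra leaves at its centre.
module Lift {G G′ : Graph} {E : EdgeSet G} {E′ : EdgeSet G′} (k t : ℕ)
  (φ : Fin (n G) → Fin (n G′)) (φ-inj : Injective _≡_ _≡_ φ)
  (φ-hom : ∀ a b → Adj G a b → Adj G′ (φ a) (φ b))
  (φ-init : ∀ a b → mem E a b ≡ true → Active (Star (suc (k + t))) G′ E′ (φ a) (φ b))
  (extra : Fin (n G) → Fin t → Fin (n G′)) (extra-inj : ∀ g → Injective _≡_ _≡_ (extra g))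
  (extra-adj : ∀ g i → Adj G′ (φ g) (extra g i))
  (extra-fresh : ∀ g i g′ → extra g i ≢ φ g′)
  (extra-active : ∀ g i → Active (Star (suc (k + t))) G′ E′ (φ g) (extra g i)) where

  Active′ : Fin (n G′) → Fin (n G′) → Set
  Active′ = Active (Star (suc (k + t))) G′ E′

  lift-step : (f : Fin (suc (suc k)) → Fin (n G)) → Injective _≡_ _≡_ f →
    (∀ c d → StarAdj c d → Adj G (f c) (f d)) → (a b : Fin (suc (suc k))) → StarAdj a b →
    (∀ c d → StarAdj c d → ¬ SameEdge c d a b → Active′ (φ (f c)) (φ (f d))) →
    Active′ (φ (f a)) (φ (f b))
  lift-step f f-inj f-hom a b ab rest =
    step ψ ψ-inj ψ-hom (a ↑ˡ t) (b ↑ˡ t) (↑ˡ-starAdj t a b ab) (ψ-left a) (ψ-left b) ψ-rest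
    where
    ψ : Fin (suc (suc k) + t) → Fin (n G′)
    ψ x = [ (λ i → φ (f i)) , extra (f zero) ]′ (splitAt (suc (suc k)) x)

    ψ-left : ∀ i → ψ (i ↑ˡ t) ≡ φ (f i)
    ψ-left i rewrite splitAt-↑ˡ (suc (suc k)) i t = refl

    ψ-right : ∀ j → ψ (suc (suc k) ↑ʳ j) ≡ extra (f zero) j
    ψ-right j rewrite splitAt-↑ʳ (suc (suc k)) t j = refl

    ψ-inj : Injective _≡_ _≡_ ψ
    ψ-inj {x} {y} eq with split (suc (suc k)) x | split (suc (suc k)) y
    ... | left i  | left j  = cong (_↑ˡ t) (f-inj (φ-inj (trans (sym (ψ-left i)) (trans eq (ψ-left j)))))
    ... | left i  | right j = ⊥-elim (extra-fresh (f zero) j (f i) (trans (sym (ψ-right j)) (trans (sym eq) (ψ-left i))))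
    ... | right i | left j  = ⊥-elim (extra-fresh (f zero) i (f j) (trans (sym (ψ-right i)) (trans eq (ψ-left j))))
    ... | right i | right j = cong (suc (suc k) ↑ʳ_) (extra-inj (f zero) (trans (sym (ψ-right i)) (trans eq (ψ-right j))))

    ψ-hom : ∀ c d → StarAdj c d → Adj G′ (ψ c) (ψ d)
    ψ-hom c d with split (suc (suc k)) c | split (suc (suc k)) d
    ... | left i       | left j       = λ cd → subst₂ (Adj G′) (sym (ψ-left i)) (sym (ψ-left j))
                                                  (φ-hom _ _ (f-hom i j (↑ˡ-starAdj⁻ t i j cd)))
    ... | left zero    | right j      = λ _ → subst (Adj G′ _) (sym (ψ-right j)) (extra-adj (f zero) j)
    ... | right i      | left zero    = λ _ → subst (λ x → Adj G′ x _) (sym (ψ-right i)) (adjSym G′ (extra-adj (f zero) i))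
    ... | left (suc i) | right j      = λ ()
    ... | right i      | left (suc j) = λ ()
    ... | right i      | right j      = λ ()

    ψ-rest : ∀ c d → StarAdj c d → ¬ SameEdge c d (a ↑ˡ t) (b ↑ˡ t) → Active′ (ψ c) (ψ d)
    ψ-rest c d with split (suc (suc k)) c | split (suc (suc k)) d
    ... | left i       | left j       = λ cd ne → subst₂ Active′ (sym (ψ-left i)) (sym (ψ-left j))
                                          (rest i j (↑ˡ-starAdj⁻ t i j cd) (λ same → ne (SameEdge-map (_↑ˡ t) same)))
    ... | left zero    | right j      = λ _ _ → subst (Active′ _) (sym (ψ-right j)) (extra-active (f zero) j)
    ... | right i      | left zero    = λ _ _ → subst (λ x → Active′ x _) (sym (ψ-right i)) (active-sym (extra-active (f zero) i))
    ... | left (suc i) | right j      = λ ()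
    ... | right i      | left (suc j) = λ ()
    ... | right i      | right j      = λ ()

  lift : ∀ {u v} → Active (Star (suc k)) G E u v → Active′ (φ u) (φ v)
  lift (init uv∈E)                                = φ-init _ _ uv∈E
  lift (step f f-inj f-hom a b ab refl refl rest) =
    lift-step f f-inj f-hom a b ab (λ c d cd ne → lift (rest c d cd ne))

∅ : (G : Graph) → EdgeSet G
∅ G = record { mem = λ _ _ → false ; memSym = λ _ _ → refl ; sub = λ _ _ () }

pairCount : {G : Graph} → EdgeSet G → Fin (n G) → Fin (n G) → ℕ
pairCount E i j = if toℕ i <ᵇ toℕ j then b2n (mem E i j) else 0

size-∅ : (G : Graph) → size (∅ G) ≡ 0
size-∅ G = trans (sumFin-cong (n G) λ i → trans (sumFin-cong (n G) λ j → if-eta (toℕ i <ᵇ toℕ j))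
                                                (sumFin-zero (n G)))
                 (sumFin-zero (n G))

-- Coordinates of G □ K N: the cell (g , h) is the copy of g in layer h.
module Coordinates (G : Graph) (N : ℕ) where

  cell : Fin (n G) → Fin N → Fin (n (G □ K N))
  cell = combine

  cell-injective : ∀ {g₁ h₁ g₂ h₂} → cell g₁ h₁ ≡ cell g₂ h₂ → g₁ ≡ g₂ × h₁ ≡ h₂
  cell-injective = combine-injective _ _ _ _

  cell-order : ∀ {g₁ g₂} h → toℕ (cell g₁ h) < toℕ (cell g₂ h) → toℕ g₁ < toℕ g₂
  cell-order {g₁} {g₂} h lt = *-cancelˡ-< N (toℕ g₁) (toℕ g₂) (+-cancelʳ-< (toℕ h) _ _
    (subst₂ _<_ (toℕ-combine g₁ h) (toℕ-combine g₂ h) lt))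

  -- Adjacency of G □ K N in coordinates; by definition Adj (G □ K N) x y is
  -- CellAdj (remQuot N x) (remQuot N y).
  CellAdj : Fin (n G) × Fin N → Fin (n G) × Fin N → Set
  CellAdj (g₁ , h₁) (g₂ , h₂) = (g₁ ≡ g₂ × h₁ ≢ h₂) ⊎ (h₁ ≡ h₂ × Adj G g₁ g₂)

  cell-adj : ∀ {g₁ h₁ g₂ h₂} → CellAdj (g₁ , h₁) (g₂ , h₂) → Adj (G □ K N) (cell g₁ h₁) (cell g₂ h₂)
  cell-adj {g₁} {h₁} {g₂} {h₂} = subst₂ CellAdj (sym (remQuot-combine g₁ h₁)) (sym (remQuot-combine g₂ h₂))

  vertical-adj : ∀ g {h₁ h₂} → h₁ ≢ h₂ → Adj (G □ K N) (cell g h₁) (cell g h₂)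
  vertical-adj g h₁≢h₂ = cell-adj (inj₁ (refl , h₁≢h₂))

  horizontal-adj : ∀ {g₁ g₂} h → Adj G g₁ g₂ → Adj (G □ K N) (cell g₁ h) (cell g₂ h)
  horizontal-adj h g₁g₂ = cell-adj (inj₂ (refl , g₁g₂))

  module _ (L : Fin N → EdgeSet G) where

    layerMem : Fin (n G) × Fin N → Fin (n G) × Fin N → Bool
    layerMem (g₁ , h₁) (g₂ , h₂) = if ⌊ h₁ ≟ h₂ ⌋ then mem (L h₁) g₁ g₂ else false

    layerMem-sym : ∀ p q → layerMem p q ≡ layerMem q p
    layerMem-sym (g₁ , h₁) (g₂ , h₂) with h₁ ≟ h₂ | h₂ ≟ h₁
    ... | yes refl | yes _     = memSym (L h₁) g₁ g₂
    ... | yes refl | no  h₁≢h₁ = ⊥-elim (h₁≢h₁ refl)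
    ... | no  h₁≢h₂ | yes h₂≡h₁ = ⊥-elim (h₁≢h₂ (sym h₂≡h₁))
    ... | no  _    | no  _     = refl

    layerMem-sub : ∀ p q → layerMem p q ≡ true → CellAdj p q
    layerMem-sub (g₁ , h₁) (g₂ , h₂) p∈ with h₁ ≟ h₂
    ... | yes refl = inj₂ (refl , sub (L h₁) g₁ g₂ p∈)

    layered : EdgeSet (G □ K N)
    layered = record
      { mem    = λ x y → layerMem (remQuot N x) (remQuot N y)
      ; memSym = λ x y → layerMem-sym (remQuot N x) (remQuot N y)
      ; sub    = λ x y → layerMem-sub (remQuot N x) (remQuot N y) }

    layered-mem : ∀ g₁ h₁ g₂ h₂ → mem layered (cell g₁ h₁) (cell g₂ h₂) ≡ layerMem (g₁ , h₁) (g₂ , h₂)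
    layered-mem g₁ h₁ g₂ h₂ = cong₂ layerMem (remQuot-combine g₁ h₁) (remQuot-combine g₂ h₂)

    layered-⊇ : ∀ {g₁ g₂} h → mem (L h) g₁ g₂ ≡ true → mem layered (cell g₁ h) (cell g₂ h) ≡ true
    layered-⊇ {g₁} {g₂} h g₁g₂∈ = trans (layered-mem g₁ h g₂ h) (diagonal (h ≟ h))
      where
      diagonal : (d : Dec (h ≡ h)) → (if ⌊ d ⌋ then mem (L h) g₁ g₂ else false) ≡ true
      diagonal (yes _)   = g₁g₂∈
      diagonal (no  h≢h) = ⊥-elim (h≢h refl)

    pairCount-cell : ∀ g₁ h₁ g₂ h₂ →
      pairCount layered (cell g₁ h₁) (cell g₂ h₂) ≤ (if ⌊ h₁ ≟ h₂ ⌋ then pairCount (L h₁) g₁ g₂ else 0)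
    pairCount-cell g₁ h₁ g₂ h₂ rewrite layered-mem g₁ h₁ g₂ h₂
      with toℕ (cell g₁ h₁) <ᵇ toℕ (cell g₂ h₂) | <ᵇ-reflects-< (toℕ (cell g₁ h₁)) (toℕ (cell g₂ h₂)) | h₁ ≟ h₂
    ... | false | _          | _        = z≤n
    ... | true  | _          | no  _    = z≤n
    ... | true  | ofʸ cells< | yes refl with toℕ g₁ <ᵇ toℕ g₂ | <ᵇ-reflects-< (toℕ g₁) (toℕ g₂)
    ...   | true  | _      = ≤-refl
    ...   | false | ofⁿ g≮ = ⊥-elim (g≮ (cell-order h₁ cells<))

    size-layered : size layered ≤ sumFin N (λ h → size (L h))
    size-layered = begin
      size layered
        ≡⟨ trans (sumFin-combine (n G) N _) (sumFin-cong (n G) λ g₁ → sumFin-cong N λ h₁ → sumFin-combine (n G) N _) ⟩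
      sumFin (n G) (λ g₁ → sumFin N λ h₁ → sumFin (n G) λ g₂ → sumFin N λ h₂ →
        pairCount layered (cell g₁ h₁) (cell g₂ h₂))
        ≤⟨ sumFin-mono (n G) (λ g₁ → sumFin-mono N λ h₁ → sumFin-mono (n G) λ g₂ → sumFin-mono N λ h₂ →
             pairCount-cell g₁ h₁ g₂ h₂) ⟩
      sumFin (n G) (λ g₁ → sumFin N λ h₁ → sumFin (n G) λ g₂ → sumFin N λ h₂ →
        if ⌊ h₁ ≟ h₂ ⌋ then pairCount (L h₁) g₁ g₂ else 0)
        ≡⟨ sumFin-cong (n G) (λ g₁ → sumFin-cong N λ h₁ → sumFin-cong (n G) λ g₂ →
             sumFin-delta N h₁ (pairCount (L h₁) g₁ g₂)) ⟩
      sumFin (n G) (λ g₁ → sumFin N λ h → sumFin (n G) λ g₂ → pairCount (L h) g₁ g₂)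
        ≡⟨ sumFin-swap (n G) N _ ⟩
      sumFin N (λ h → size (L h)) ∎
      where open ≤-Reasoning

below : ∀ {N} (t : Fin N) → Fin (toℕ t) → Fin N
below t = inject

below-< : ∀ {N} (t : Fin N) j → toℕ (below t j) < toℕ t
below-< t j = subst (_< toℕ t) (sym (toℕ-inject j)) (toℕ<n j)

below-injective : ∀ {N} (t : Fin N) → Injective _≡_ _≡_ (below t)
below-injective t {i} {j} eq = toℕ-injective (trans (sym (toℕ-inject i)) (trans (cong toℕ eq) (toℕ-inject j)))

module LayeredPercolation (G : Graph) (N r : ℕ) (min-degree : MinDegreeAtLeast G r)
  (L : Fin N → EdgeSet G)
  (L-percolates : ∀ h → toℕ h < r → Percolates G (Star (suc (r ∸ toℕ h))) (L h)) where

  open Coordinates G N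

  ActiveIn : ℕ → Fin (n (G □ K N)) → Fin (n (G □ K N)) → Set
  ActiveIn k = Active (Star (suc k)) (G □ K N) (layered L)

  LayerActive : Fin N → Set
  LayerActive t = ∀ g₁ g₂ → Adj G g₁ g₂ → ActiveIn r (cell g₁ t) (cell g₂ t)

  RisersActive : Fin N → Set
  RisersActive t = ∀ g s → toℕ s < toℕ t → ActiveIn r (cell g s) (cell g t)

  -- The riser (g,s)(g,t) is closed by the star at (g,s) whose other leaves are r
  -- neighbours of g inside the (already active) layer s.
  risers-active : ∀ t → (∀ s → toℕ s < toℕ t → LayerActive s) → RisersActive t
  risers-active t layers g s s<t =
    star-rule (vertical-adj g (<⇒≢ s<t)) (λ i → cell (nbr i) s) leaves-inj
      (λ i → horizontal-adj s (nbr-adj i)) (λ i eq → <⇒≢ s<t (proj₂ (cell-injective eq)))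
      (λ i → layers s s<t g (nbr i) (nbr-adj i))
    where
    neighbours : Σ (Fin r → Fin (n G)) λ w → Injective _≡_ _≡_ w × (∀ i → Adj G g (w i))
    neighbours = choose (Adj G g) (adj? G g) r (min-degree g)

    nbr : Fin r → Fin (n G)
    nbr = proj₁ neighbours

    nbr-adj : ∀ i → Adj G g (nbr i)
    nbr-adj = proj₂ (proj₂ neighbours)

    leaves-inj : Injective _≡_ _≡_ (λ i → cell (nbr i) s)
    leaves-inj eq = proj₁ (proj₂ neighbours) (proj₁ (cell-injective eq))

  -- A layer t < r: the risers give every vertex of the layer t extra active edges,
  -- so S_{r-t+1}-percolation of L t lifts to S_{r+1}-percolation.
  low-layer : ∀ t → toℕ t < r → RisersActive t → LayerActive t
  low-layer t t<r risers g₁ g₂ g₁g₂ =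
    subst (λ k → ActiveIn k (cell g₁ t) (cell g₂ t)) k+t≡r (Lifted.lift (L-percolates t t<r g₁ g₂ g₁g₂))
    where
    k+t≡r : r ∸ toℕ t + toℕ t ≡ r
    k+t≡r = m∸n+n≡m (<⇒≤ t<r)

    module Lifted = Lift {E = L t} {E′ = layered L} (r ∸ toℕ t) (toℕ t)
      (λ g → cell g t) (λ eq → proj₁ (cell-injective eq))
      (λ _ _ → horizontal-adj t) (λ _ _ ab∈ → init (layered-⊇ L t ab∈))
      (λ g j → cell g (below t j)) (λ g eq → below-injective t (proj₂ (cell-injective eq)))
      (λ g j → vertical-adj g (λ eq → <⇒≢ (below-< t j) (sym eq)))
      (λ g j g′ eq → <⇒≢ (below-< t j) (proj₂ (cell-injective eq)))
      (λ g j → subst (λ k → ActiveIn k _ _) (sym k+t≡r) (active-sym (risers g (below t j) (below-< t j))))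

  -- A layer t ≥ r: each edge of the layer is closed by a star using r risers.
  high-layer : ∀ t → r ≤ toℕ t → RisersActive t → LayerActive t
  high-layer t r≤t risers g₁ g₂ g₁g₂ =
    star-rule (horizontal-adj t g₁g₂) (λ i → cell g₁ (lower i)) leaves-inj
      (λ i → vertical-adj g₁ (λ eq → <⇒≢ (lower-< i) (sym eq)))
      (λ i eq → <⇒≢ (lower-< i) (proj₂ (cell-injective eq)))
      (λ i → active-sym (risers g₁ (lower i) (lower-< i)))
    where
    lower : Fin r → Fin N
    lower i = below t (inject≤ i r≤t)

    lower-< : ∀ i → toℕ (lower i) < toℕ t
    lower-< i = below-< t (inject≤ i r≤t)

    leaves-inj : Injective _≡_ _≡_ (λ i → cell g₁ (lower i))
    leaves-inj eq = inject≤-injective r≤t r≤t _ _ (below-injective t (proj₂ (cell-injective eq)))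

  layer-active : ∀ t → RisersActive t → LayerActive t
  layer-active t with toℕ t <? r
  ... | yes t<r = low-layer t t<r
  ... | no  t≮r = high-layer t (≮⇒≥ t≮r)

  all-layers : ∀ t → LayerActive t
  all-layers = All.wfRec <-wellFounded _ LayerActive
    (λ t lower → layer-active t (risers-active t (λ s s<t → lower s<t)))

  all-risers : ∀ t → RisersActive t
  all-risers t = risers-active t (λ s _ → all-layers s)

  percolates : Percolates (G □ K N) (Star (suc r)) (layered L)
  percolates x y xy =
    subst₂ (ActiveIn r) (combine-remQuot {n G} N x) (combine-remQuot {n G} N y) (cells-active xy)
    where
    cells-active : ∀ {g₁ h₁ g₂ h₂} → CellAdj (g₁ , h₁) (g₂ , h₂) → ActiveIn r (cell g₁ h₁) (cell g₂ h₂)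
    cells-active (inj₂ (refl , g₁g₂)) = all-layers _ _ _ g₁g₂
    cells-active {h₁ = h₁} {h₂ = h₂} (inj₁ (refl , h₁≢h₂)) with <-cmp h₁ h₂
    ... | tri< h₁<h₂ _ _ = all-risers h₂ _ h₁ h₁<h₂
    ... | tri≈ _ h₁≡h₂ _ = ⊥-elim (h₁≢h₂ h₁≡h₂)
    ... | tri> _ _ h₂<h₁ = active-sym (all-risers h₁ _ h₂ h₂<h₁)

module MinimumLayers (G : Graph) (N r : ℕ) (m : ℕ → ℕ)
  (m-is-me : ∀ t → t < N → t < r → IsMe G (r ∸ t) (m t)) where

  layers : Fin N → EdgeSet G
  layers h with toℕ h <ᵇ r | <ᵇ-reflects-< (toℕ h) r
  ... | true  | ofʸ h<r = proj₁ (proj₁ (m-is-me (toℕ h) (toℕ<n h) h<r))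
  ... | false | ofⁿ _   = ∅ G

  layers-size : ∀ h → size (layers h) ≡ (if toℕ h <ᵇ r then m (toℕ h) else 0)
  layers-size h with toℕ h <ᵇ r | <ᵇ-reflects-< (toℕ h) r
  ... | true  | ofʸ h<r = proj₂ (proj₂ (proj₁ (m-is-me (toℕ h) (toℕ<n h) h<r)))
  ... | false | ofⁿ _   = size-∅ G

  layers-percolate : ∀ h → toℕ h < r → Percolates G (Star (suc (r ∸ toℕ h))) (layers h)
  layers-percolate h h<r with toℕ h <ᵇ r | <ᵇ-reflects-< (toℕ h) r
  ... | true  | ofʸ h<r′ = proj₁ (proj₂ (proj₁ (m-is-me (toℕ h) (toℕ<n h) h<r′)))
  ... | false | ofⁿ h≮r = ⊥-elim (h≮r h<r)

lemma3p5 : (n r : ℕ) → 1 ≤ n → 1 ≤ r → (G : Graph) → MinDegreeAtLeast G r →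
    (m : ℕ → ℕ) → (∀ t → t < n → t < r → IsMe G (r ∸ t) (m t)) →
    (M : ℕ) → IsMe (G □ K n) r M →
    M ≤ sumTo n (λ t → if t <ᵇ r then m t else 0)
lemma3p5 N r _ _ G min-degree m m-is-me M M-is-me = begin
  M                                                        ≤⟨ proj₂ M-is-me (layered layers) percolating ⟩
  size (layered layers)                                    ≤⟨ size-layered layers ⟩
  sumFin N (λ h → size (layers h))                         ≡⟨ sumFin-cong N layers-size ⟩
  sumFin N (λ h → if toℕ h <ᵇ r then m (toℕ h) else 0)     ≡⟨ sumFin-sumTo N (λ t → if t <ᵇ r then m t else 0) ⟩
  sumTo N (λ t → if t <ᵇ r then m t else 0)                ∎
  where
  open ≤-Reasoning
  open Coordinates G N
  open MinimumLayers G N r m m-is-me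
  percolating : Percolates (G □ K N) (Star (suc r)) (layered layers)
  percolating = LayeredPercolation.percolates G N r min-degree layers layers-percolate
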